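{- Let $p$ be a prime and $k$ a positive divisor of $p-1$. Let $T(e,p)=\#\{h\in\{1,\ldots,p-1\}\colon h\equiv y^{e}\pmod p\text{ for some integer }y,\ \gcd(h,p-1)=e\}$ for $e\mid p-1$. Then \[ T\left(\frac{p-1}{k},p\right)=\#\{j\colon 1\le j\le k,\ \gcd(j,k)=1,\ (-j)^{k}\equiv k^{k}\pmod p\}. \] -}

module Defs where

open import Data.Nat using (ℕ; _≤_; _∸_; suc)
open import Data.Nat.GCD using (gcd)
open import Data.Integer as ℤ using (ℤ; +_; _-_; -_)
open import Data.Integer.Divisibility using () renaming (_∣_ to _∣ℤ_)
open import Data.List using (List; length)
open import Data.List.Membership.Propositional using (_∈_)
open import Data.List.Relation.Unary.Unique.Propositional using (Unique)
open import Data.Product using (Σ; ∃; _×_)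
open import Function.Bundles using (_⇔_)
open import Relation.Binary.PropositionalEquality using (_≡_)

_≡_[mod_] : ℤ → ℤ → ℕ → Set
a ≡ b [mod m ] = (+ m) ∣ℤ (a - b)

HasSize : (ℕ → Set) → ℕ → Set
HasSize P n = Σ (List ℕ) λ xs → Unique xs × length xs ≡ n × (∀ x → (x ∈ xs) ⇔ P x)

TSet : ℕ → ℕ → ℕ → Set
TSet e p h = (1 ≤ h) × (h ≤ p ∸ 1)
           × (∃ λ (y : ℤ) → (+ h) ≡ (y ℤ.^ e) [mod p ])
           × (gcd h (p ∸ 1) ≡ e)

JSet : ℕ → ℕ → ℕ → Set
JSet k p j = (1 ≤ j) × (j ≤ k) × (gcd j k ≡ 1)
           × ((- (+ j)) ℤ.^ k) ≡ ((+ k) ℤ.^ k) [mod p ]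

-- Put e = (p - 1)/k. Multiplication by e maps the j-set onto the h-set:
-- gcd (e j) (p - 1) = e · gcd j k, so the gcd conditions correspond and every h with
-- gcd h (p - 1) = e is a multiple of e. As e k = p - 1 ≡ -1 (mod p), k^k (e j)^k ≡ (-j)^k,
-- so (-j)^k ≡ k^k iff (e j)^k ≡ 1, which by Euler's criterion says that e j is an e-th
-- power residue. Euler's criterion rests on Fermat's little theorem (from the freshman's
-- dream) and, for the converse, on Lagrange's bound for the number of roots of a
-- polynomial modulo p.

module Submission where

open import Defs
open import Data.Nat using (ℕ; _∸_; _/_; NonZero)
open import Data.Nat.Divisibility using (_∣_)
open import Data.Nat.Primality using (Prime)
open import Data.Product using (∃; _×_)

open import Data.Empty using (⊥-elim)
open import Data.Fin as Fin using (Fin; toℕ; fromℕ; inject₁)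
import Data.Fin.Properties as Fin
open import Data.Integer as ℤ using (ℤ; +_; _+_; _-_; -_; _*_; _^_; ∣_∣; 0ℤ; 1ℤ; -1ℤ)
import Data.Integer.DivMod as ℤ
open import Data.Integer.Divisibility.Signed as Signed
  using (divides; ∣ᵤ⇒∣; ∣⇒∣ᵤ) renaming (_∣_ to _∣ℤ_)
import Data.Integer.Properties as ℤ
open import Data.Integer.Tactic.RingSolver using (solve-∀)
open import Algebra.Properties.CommutativeSemiring.Binomial ℤ.+-*-commutativeSemiring as Binomial
  using (binomial; binomialTerm; binomialExpansion)
import Algebra.Properties.CommutativeSemiring.Exp ℤ.+-*-commutativeSemiring as Exp
open import Algebra.Properties.Monoid.Sum ℤ.+-0-monoid using (sum; sum-init-last)
open import Algebra.Properties.Semiring.Exp ℤ.+-*-semiring using () renaming (_^_ to _^ₛ_)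
open import Algebra.Properties.Semiring.Mult ℤ.+-*-semiring using () renaming (_×_ to _×ₛ_)
open import Data.List using (List; []; _∷_; length; replicate; _++_; applyUpTo; map; filter; upTo)
import Data.List.Properties as List
open import Data.List.Membership.Propositional using (_∈_)
import Data.List.Membership.Propositional.Properties as Membership
open import Data.List.Relation.Unary.All as All using (All; []; _∷_)
import Data.List.Relation.Unary.All.Properties as All
open import Data.List.Relation.Unary.AllPairs using (AllPairs; []; _∷_)
import Data.List.Relation.Unary.AllPairs.Properties as AllPairs
import Data.List.Relation.Unary.Unique.Propositional.Properties as Unique
open import Data.Nat as ℕ using (zero; suc; _≤_; _<_; z≤n; s≤s; z<s; _!)
open import Data.Nat.Combinatorics using (_C_; nCn≡1; nCk≡n!/k![n-k]!; k![n∸k]!∣n!)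
import Data.Nat.DivMod as ℕ
import Data.Nat.Divisibility as ℕ
open import Data.Nat.GCD using (gcd; gcd[m,n]∣m; c*gcd[m,n]≡gcd[cm,cn])
open import Data.Nat.Primality using (euclidsLemma; prime⇒nonZero; prime⇒nonTrivial)
import Data.Nat.Properties as ℕ
open import Data.Product using (_,_; proj₂; ∃-syntax; map₂)
open import Data.Sum using (_⊎_; inj₁; inj₂; [_,_]′)
import Data.Sum as Sum
open import Data.Vec.Functional using (init; tail; last)
open import Function using (_∘_; id)
open import Function.Bundles using (_⇔_; mk⇔; Equivalence)
import Function.Properties.Equivalence as ⇔
open import Relation.Binary.Bundles using (Setoid)
open import Relation.Binary.PropositionalEquality
  using (_≡_; refl; sym; trans; cong; cong₂; subst; subst₂; module ≡-Reasoning)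
open import Relation.Nullary using (¬_; Dec; yes; no)
open import Relation.Nullary.Decidable using (map′; _×-dec_)
open import Relation.Unary using (Decidable)

m∣n∧n<m⇒n≡0 : ∀ {m n} → m ∣ n → n < m → n ≡ 0
m∣n∧n<m⇒n≡0 {n = zero}  _   _   = refl
m∣n∧n<m⇒n≡0 {n = suc _} m∣n n<m = ⊥-elim (ℕ.<⇒≱ n<m (ℕ.∣⇒≤ m∣n))

n∣n! : ∀ n .{{_ : NonZero n}} → n ∣ n !
n∣n! (suc n) = ℕ.m∣m*n (n !)

nCk*k![n∸k]!≡n! : ∀ {n k} → k ≤ n → (n C k) ℕ.* (k ! ℕ.* (n ∸ k) !) ≡ n !
nCk*k![n∸k]!≡n! {n} {k} k≤n = begin
  (n C k) ℕ.* d        ≡⟨ cong (ℕ._* d) (nCk≡n!/k![n-k]! k≤n) ⟩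
  (n ! ℕ./ d) ℕ.* d    ≡⟨ ℕ.m/n*n≡m (k![n∸k]!∣n! k≤n) ⟩
  n !                  ∎
  where
    d = k ! ℕ.* (n ∸ k) !
    instance _ = ℕ._!*_!≢0 k (n ∸ k)
    open ≡-Reasoning

HasSize-filter : ∀ {P : ℕ → Set} (P? : Decidable P) b → (∀ {x} → P x → x < b) →
                 HasSize P (length (filter P? (upTo b)))
HasSize-filter P? b bounded =
  filter P? (upTo b) , Unique.filter⁺ P? (Unique.upTo⁺ b) , refl ,
  λ _ → mk⇔ (proj₂ ∘ Membership.∈-filter⁻ P? {xs = upTo b})
            (λ Px → Membership.∈-filter⁺ P? {xs = upTo b} (Membership.∈-upTo⁺ (bounded Px)) Px)

HasSize-map : ∀ {P Q : ℕ → Set} {n} (f : ℕ → ℕ) → (∀ {i j} → f i ≡ f j → i ≡ j) →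
              (∀ {x} → P x → ∃[ j ] x ≡ f j) → (∀ j → Q j ⇔ P (f j)) → HasSize Q n → HasSize P n
HasSize-map {P} {Q} f f-injective P⊆image Q⇔P∘f (js , unique , length≡n , ∈js⇔Q) =
  map f js , Unique.map⁺ f-injective unique , trans (List.length-map f js) length≡n , λ _ → mk⇔ to from
  where
    to : ∀ {x} → x ∈ map f js → P x
    to x∈ with Membership.∈-map⁻ f x∈
    ... | j , j∈js , refl = Equivalence.to (Q⇔P∘f j) (Equivalence.to (∈js⇔Q j) j∈js)
    from : ∀ {x} → P x → x ∈ map f js
    from Px with P⊆image Px
    ... | j , refl = Membership.∈-map⁺ f (Equivalence.from (∈js⇔Q j) (Equivalence.from (Q⇔P∘f j) Px))

-- The library's binomial theorem uses the semiring's own power and ℕ-multiple, which agree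
-- with those of ℤ only propositionally.
^ₛ≡^ : ∀ x n → x ^ₛ n ≡ x ^ n
^ₛ≡^ x zero    = refl
^ₛ≡^ x (suc n) = cong (x *_) (^ₛ≡^ x n)

×ₛ≡* : ∀ n x → n ×ₛ x ≡ + n * x
×ₛ≡* zero    x = refl
×ₛ≡* (suc n) x = begin
  x + n ×ₛ x        ≡⟨ cong (_+_ x) (×ₛ≡* n x) ⟩
  x + + n * x       ≡⟨ cong (_+ + n * x) (ℤ.*-identityˡ x) ⟨
  1ℤ * x + + n * x  ≡⟨ ℤ.*-distribʳ-+ x 1ℤ (+ n) ⟨
  + suc n * x       ∎
  where open ≡-Reasoning

^-distribʳ-* : ∀ x y n → (x * y) ^ n ≡ x ^ n * y ^ n
^-distribʳ-* x y n = begin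
  (x * y) ^ n      ≡⟨ ^ₛ≡^ (x * y) n ⟨
  (x * y) ^ₛ n     ≡⟨ Exp.^-distrib-* x y n ⟩
  x ^ₛ n * y ^ₛ n  ≡⟨ cong₂ _*_ (^ₛ≡^ x n) (^ₛ≡^ y n) ⟩
  x ^ n * y ^ n    ∎
  where open ≡-Reasoning

binomialTerm-first : ∀ x y n → binomialTerm x y n Fin.zero ≡ y ^ n
binomialTerm-first x y n = begin
  1ℤ * y ^ₛ n + 0ℤ  ≡⟨ ℤ.+-identityʳ _ ⟩
  1ℤ * y ^ₛ n       ≡⟨ ℤ.*-identityˡ _ ⟩
  y ^ₛ n            ≡⟨ ^ₛ≡^ y n ⟩
  y ^ n             ∎
  where open ≡-Reasoning

binomialTerm-last : ∀ x y n → binomialTerm x y n (fromℕ n) ≡ x ^ n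
binomialTerm-last x y n rewrite Fin.toℕ-fromℕ n | nCn≡1 n | ℕ.n∸n≡0 n = begin
  x ^ₛ n * 1ℤ + 0ℤ  ≡⟨ ℤ.+-identityʳ _ ⟩
  x ^ₛ n * 1ℤ       ≡⟨ ℤ.*-identityʳ _ ⟩
  x ^ₛ n            ≡⟨ ^ₛ≡^ x n ⟩
  x ^ n             ∎
  where open ≡-Reasoning

-- eval l cs x = c₀ + x (c₁ + ⋯ + x (c_{d-1} + x l)) for cs = c₀ ∷ ⋯ ∷ c_{d-1}: a polynomial
-- of degree d = length cs whose leading coefficient l is kept apart from the others.
eval : ℤ → List ℤ → ℤ → ℤ
eval l []       x = l
eval l (c ∷ cs) x = c + x * eval l cs x

ruffini : ℤ → ℤ → List ℤ → List ℤ
ruffini l a []       = []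
ruffini l a (c ∷ cs) = eval l (c ∷ cs) a ∷ ruffini l a cs

length-ruffini : ∀ l a cs → length (ruffini l a cs) ≡ length cs
length-ruffini l a []       = refl
length-ruffini l a (c ∷ cs) = cong suc (length-ruffini l a cs)

private
  linear-difference : ∀ c x a l → (c + x * l) - (c + a * l) ≡ (x - a) * l
  linear-difference = solve-∀

  horner-difference : ∀ c x a Fx Fa → (c + x * Fx) - (c + a * Fa) ≡ x * (Fx - Fa) + (x - a) * Fa
  horner-difference = solve-∀

  horner-factor : ∀ x a Q Fa → x * ((x - a) * Q) + (x - a) * Fa ≡ (x - a) * (Fa + x * Q)
  horner-factor = solve-∀

eval-ruffini : ∀ l a c cs x →
               eval l (c ∷ cs) x - eval l (c ∷ cs) a ≡ (x - a) * eval l (ruffini l a cs) x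
eval-ruffini l a c []        x = linear-difference c x a l
eval-ruffini l a c (c′ ∷ cs) x = begin
  (c + x * Fx) - (c + a * Fa)       ≡⟨ horner-difference c x a Fx Fa ⟩
  x * (Fx - Fa) + (x - a) * Fa      ≡⟨ cong (λ d → x * d + (x - a) * Fa) (eval-ruffini l a c′ cs x) ⟩
  x * ((x - a) * Q) + (x - a) * Fa  ≡⟨ horner-factor x a Q Fa ⟩
  (x - a) * (Fa + x * Q)            ∎
  where
    Fx = eval l (c′ ∷ cs) x
    Fa = eval l (c′ ∷ cs) a
    Q  = eval l (ruffini l a cs) x
    open ≡-Reasoning

stretch : ℕ → List ℤ → List ℤ
stretch e []       = []
stretch e (c ∷ cs) = c ∷ replicate e 0ℤ ++ stretch e cs

length-stretch : ∀ e cs → length (stretch e cs) ≡ length cs ℕ.* suc e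
length-stretch e []       = refl
length-stretch e (c ∷ cs) = cong suc (begin
  length (replicate e 0ℤ ++ stretch e cs)
    ≡⟨ List.length-++ (replicate e 0ℤ) ⟩
  length (replicate e 0ℤ) ℕ.+ length (stretch e cs)
    ≡⟨ cong₂ ℕ._+_ (List.length-replicate e) (length-stretch e cs) ⟩
  e ℕ.+ length cs ℕ.* suc e
    ∎)
  where open ≡-Reasoning

private
  shift-power : ∀ x X E → 0ℤ + x * (X * E) ≡ x * X * E
  shift-power = solve-∀

eval-zeros : ∀ l m cs x → eval l (replicate m 0ℤ ++ cs) x ≡ x ^ m * eval l cs x
eval-zeros l zero    cs x = sym (ℤ.*-identityˡ _)
eval-zeros l (suc m) cs x = trans (cong (λ v → 0ℤ + x * v) (eval-zeros l m cs x)) (shift-power x (x ^ m) _)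

eval-stretch : ∀ l e cs x → eval l (stretch e cs) x ≡ eval l cs (x ^ suc e)
eval-stretch l e []       x = refl
eval-stretch l e (c ∷ cs) x = cong (_+_ c) (begin
  x * eval l (replicate e 0ℤ ++ stretch e cs) x  ≡⟨ cong (x *_) (eval-zeros l e (stretch e cs) x) ⟩
  x * (x ^ e * eval l (stretch e cs) x)          ≡⟨ ℤ.*-assoc x (x ^ e) _ ⟨
  x ^ suc e * eval l (stretch e cs) x            ≡⟨ cong (x ^ suc e *_) (eval-stretch l e cs x) ⟩
  x ^ suc e * eval l cs (x ^ suc e)              ∎)
  where open ≡-Reasoning

geometric : ℤ → ℕ → List ℤ
geometric h zero    = []
geometric h (suc m) = h ^ suc m ∷ geometric h m

length-geometric : ∀ h m → length (geometric h m) ≡ m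
length-geometric h zero    = refl
length-geometric h (suc m) = cong suc (length-geometric h m)

private
  linear-times-one : ∀ z h → (z - h) * 1ℤ ≡ z * 1ℤ - h * 1ℤ
  linear-times-one = solve-∀

  geometric-expand : ∀ z h H G → (z - h) * (H + z * G) ≡ (z - h) * H + z * ((z - h) * G)
  geometric-expand = solve-∀

  geometric-collapse : ∀ z h H Z → (z - h) * H + z * (Z - H) ≡ z * Z - h * H
  geometric-collapse = solve-∀

eval-geometric : ∀ h m z → (z - h) * eval 1ℤ (geometric h m) z ≡ z ^ suc m - h ^ suc m
eval-geometric h zero    z = linear-times-one z h
eval-geometric h (suc m) z = begin
  (z - h) * (H + z * G)              ≡⟨ geometric-expand z h H G ⟩
  (z - h) * H + z * ((z - h) * G)    ≡⟨ cong (λ v → (z - h) * H + z * v) (eval-geometric h m z) ⟩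
  (z - h) * H + z * (z ^ suc m - H)  ≡⟨ geometric-collapse z h H (z ^ suc m) ⟩
  z * z ^ suc m - h * H              ∎
  where
    H = h ^ suc m
    G = eval 1ℤ (geometric h m) z
    open ≡-Reasoning

module Congruence (n : ℕ) where

  private
    neg-difference : ∀ a b → - (a - b) ≡ b - a
    neg-difference = solve-∀

    difference-chain : ∀ a b c → (a - b) + (b - c) ≡ a - c
    difference-chain = solve-∀

    difference-+ : ∀ a b c d → (a - b) + (c - d) ≡ (a + c) - (b + d)
    difference-+ = solve-∀

    difference-* : ∀ a b c d → (a - b) * c + b * (c - d) ≡ a * c - b * d
    difference-* = solve-∀

    +-sub : ∀ r x → (r + x) - r ≡ x
    +-sub = solve-∀

  infix 4 _≈_ _≉_ _≈?_

  -- A record rather than a function into divisibility, so that a and b are inferable.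
  record _≈_ (a b : ℤ) : Set where
    constructor mk≈
    field n∣a-b : + n ∣ℤ a - b

  open _≈_ public

  _≉_ : ℤ → ℤ → Set
  a ≉ b = ¬ a ≈ b

  ≈-refl : ∀ {a} → a ≈ a
  ≈-refl {a} = mk≈ (divides 0ℤ (ℤ.+-inverseʳ a))

  ≈-reflexive : ∀ {a b} → a ≡ b → a ≈ b
  ≈-reflexive refl = ≈-refl

  ≈-sym : ∀ {a b} → a ≈ b → b ≈ a
  ≈-sym {a} {b} (mk≈ d) = mk≈ (subst (+ n ∣ℤ_) (neg-difference a b) (Signed.∣m⇒∣-m d))

  ≈-trans : ∀ {a b c} → a ≈ b → b ≈ c → a ≈ c
  ≈-trans {a} {b} {c} (mk≈ d) (mk≈ d′) =
    mk≈ (subst (+ n ∣ℤ_) (difference-chain a b c) (Signed.∣m∣n⇒∣m+n d d′))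

  ≈-setoid : Setoid _ _
  ≈-setoid = record
    { Carrier       = ℤ
    ; _≈_           = _≈_
    ; isEquivalence = record { refl = ≈-refl ; sym = ≈-sym ; trans = ≈-trans }
    }

  _≈?_ : ∀ a b → Dec (a ≈ b)
  a ≈? b = map′ mk≈ n∣a-b (+ n Signed.∣? (a - b))

  +-cong : ∀ {a b c d} → a ≈ b → c ≈ d → a + c ≈ b + d
  +-cong {a} {b} {c} {d} (mk≈ x) (mk≈ y) =
    mk≈ (subst (+ n ∣ℤ_) (difference-+ a b c d) (Signed.∣m∣n⇒∣m+n x y))

  *-cong : ∀ {a b c d} → a ≈ b → c ≈ d → a * c ≈ b * d
  *-cong {a} {b} {c} {d} (mk≈ x) (mk≈ y) =
    mk≈ (subst (+ n ∣ℤ_) (difference-* a b c d)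
      (Signed.∣m∣n⇒∣m+n (Signed.∣m⇒∣m*n c x) (Signed.∣n⇒∣m*n b y)))

  ^-congˡ : ∀ m {a b} → a ≈ b → a ^ m ≈ b ^ m
  ^-congˡ zero    a≈b = ≈-refl
  ^-congˡ (suc m) a≈b = *-cong a≈b (^-congˡ m a≈b)

  ∣⇒≈0 : ∀ {a} → + n ∣ℤ a → a ≈ 0ℤ
  ∣⇒≈0 {a} d = mk≈ (subst (+ n ∣ℤ_) (sym (ℤ.+-identityʳ a)) d)

  ≈0⇒∣ : ∀ {a} → a ≈ 0ℤ → + n ∣ℤ a
  ≈0⇒∣ {a} (mk≈ d) = subst (+ n ∣ℤ_) (ℤ.+-identityʳ a) d

  a≈b⇒a-b≈0 : ∀ {a b} → a ≈ b → a - b ≈ 0ℤ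
  a≈b⇒a-b≈0 = ∣⇒≈0 ∘ n∣a-b

  a-b≈0⇒a≈b : ∀ {a b} → a - b ≈ 0ℤ → a ≈ b
  a-b≈0⇒a≈b = mk≈ ∘ ≈0⇒∣

  ≡[mod]⇒≈ : ∀ {a b} → a ≡ b [mod n ] → a ≈ b
  ≡[mod]⇒≈ d = mk≈ (∣ᵤ⇒∣ d)

  ≈⇒≡[mod] : ∀ {a b} → a ≈ b → a ≡ b [mod n ]
  ≈⇒≡[mod] (mk≈ d) = ∣⇒∣ᵤ d

  x≈x%ℕn : ∀ x .{{_ : NonZero n}} → x ≈ + (x ℤ.%ℕ n)
  x≈x%ℕn x = mk≈ (divides q (begin
    x - r                ≡⟨ cong (_- r) (ℤ.a≡a%ℕn+[a/ℕn]*n x n) ⟩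
    (r + q * + n) - r    ≡⟨ +-sub r (q * + n) ⟩
    q * + n              ∎))
    where
      r = + (x ℤ.%ℕ n)
      q = x ℤ./ℕ n
      open ≡-Reasoning

  +a≈+b⇒a≡b : ∀ {a b} → a < n → b < n → + a ≈ + b → a ≡ b
  +a≈+b⇒a≡b {a} {b} a<n b<n (mk≈ n∣a-b) =
    ℤ.+-injective (ℤ.i-j≡0⇒i≡j (+ a) (+ b)
      (ℤ.∣i∣≡0⇒i≡0 (m∣n∧n<m⇒n≡0 (∣⇒∣ᵤ n∣a-b) ∣a-b∣<n)))
    where
      ∣a-b∣<n : ∣ + a - + b ∣ < n
      ∣a-b∣<n = subst (_< n) (cong ∣_∣ (sym (ℤ.[+m]-[+n]≡m⊖n a b)))
                  (ℕ.≤-<-trans (ℤ.∣m⊝n∣≤m⊔n a b) (ℕ.⊔-lub a<n b<n))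

  [n-1]≈-1 : 0 < n → + (n ∸ 1) ≈ -1ℤ
  [n-1]≈-1 0<n = mk≈ (divides 1ℤ (trans (cong +_ (ℕ.m∸n+n≡m 0<n)) (sym (ℤ.*-identityˡ (+ n)))))

  power-scaling : ∀ {a b} → a * b ≈ -1ℤ → ∀ m x → a ^ m * (b * x) ^ m ≈ (- x) ^ m
  power-scaling {a} {b} ab≈-1 m x = begin
    a ^ m * (b * x) ^ m  ≡⟨ ^-distribʳ-* a (b * x) m ⟨
    (a * (b * x)) ^ m    ≡⟨ cong (_^ m) (ℤ.*-assoc a b x) ⟨
    (a * b * x) ^ m      ≈⟨ ^-congˡ m (*-cong ab≈-1 (≈-refl {x})) ⟩
    (-1ℤ * x) ^ m        ≡⟨ cong (_^ m) (ℤ.-1*i≡-i x) ⟩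
    (- x) ^ m            ∎
    where open import Relation.Binary.Reasoning.Setoid ≈-setoid

  sum≈0 : ∀ {m} (t : Fin m → ℤ) → (∀ i → t i ≈ 0ℤ) → sum t ≈ 0ℤ
  sum≈0 {zero}  t t≈0 = ≈-refl
  sum≈0 {suc m} t t≈0 = +-cong (t≈0 Fin.zero) (sum≈0 (tail t) (t≈0 ∘ Fin.suc))

  sum≈head+last : ∀ {m} (t : Fin (2 ℕ.+ m) → ℤ) → (∀ i → t (Fin.suc (inject₁ i)) ≈ 0ℤ) →
                  sum t ≈ t Fin.zero + last t
  sum≈head+last t inner≈0 = begin
    t₀ + sum (tail t)
      ≡⟨ cong (_+_ t₀) (sum-init-last (tail t)) ⟩
    t₀ + (sum (init (tail t)) + last t)
      ≈⟨ +-cong (≈-refl {t₀}) (+-cong (sum≈0 _ inner≈0) (≈-refl {last t})) ⟩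
    t₀ + (0ℤ + last t)
      ≡⟨ cong (_+_ t₀) (ℤ.+-identityˡ (last t)) ⟩
    t₀ + last t
      ∎
    where
      t₀ = t Fin.zero
      open import Relation.Binary.Reasoning.Setoid ≈-setoid

  freshmans-dream : ∀ {q} x y → 0 < q → (∀ {k} → 0 < k → k < q → n ∣ q C k) →
                    (x + y) ^ q ≈ x ^ q + y ^ q
  freshmans-dream {q@(suc m)} x y _ n∣qCk = begin
    (x + y) ^ q                ≡⟨ ^ₛ≡^ (x + y) q ⟨
    (x + y) ^ₛ q               ≡⟨ Binomial.theorem q x y ⟩
    binomialExpansion x y q    ≈⟨ sum≈head+last (binomialTerm x y q) inner≈0 ⟩
    binomialTerm x y q Fin.zero + binomialTerm x y q (fromℕ q)
                               ≡⟨ cong₂ _+_ (binomialTerm-first x y q) (binomialTerm-last x y q) ⟩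
    y ^ q + x ^ q              ≡⟨ ℤ.+-comm (y ^ q) (x ^ q) ⟩
    x ^ q + y ^ q              ∎
    where
      open import Relation.Binary.Reasoning.Setoid ≈-setoid
      inner≈0 : ∀ (i : Fin m) → binomialTerm x y q (Fin.suc (inject₁ i)) ≈ 0ℤ
      inner≈0 i = ∣⇒≈0 (subst (+ n ∣ℤ_) (sym (×ₛ≡* (q C k) b))
                    (Signed.∣m⇒∣m*n b (∣ᵤ⇒∣ {+ n} {+ (q C k)} (n∣qCk z<s k<q))))
        where
          b = binomial x y q (Fin.suc (inject₁ i))
          k = suc (toℕ (inject₁ i))
          k<q : k < q
          k<q = s≤s (subst (_< m) (sym (Fin.toℕ-inject₁ i)) (Fin.toℕ<n i))

module PrimeModulus {p : ℕ} (p-prime : Prime p) where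

  open Congruence p

  private
    *-distribˡ-- : ∀ c a b → c * a - c * b ≡ c * (a - b)
    *-distribˡ-- = solve-∀

  instance
    p≢0 : NonZero p
    p≢0 = prime⇒nonZero p-prime

  1<p : 1 < p
  1<p = ℕ.nonTrivial⇒n>1 p {{prime⇒nonTrivial p-prime}}

  1+[p-1]≡p : suc (p ∸ 1) ≡ p
  1+[p-1]≡p = ℕ.m+[n∸m]≡n (ℕ.<⇒≤ 1<p)

  ≤p-1⇒<p : ∀ {a} → a ≤ p ∸ 1 → a < p
  ≤p-1⇒<p a≤p-1 = subst (_ <_) 1+[p-1]≡p (s≤s a≤p-1)

  +≉0 : ∀ {a} → 0 < a → a < p → + a ≉ 0ℤ
  +≉0 0<a a<p a≈0 = ℕ.<⇒≢ 0<a (sym (+a≈+b⇒a≡b a<p (ℕ.<-trans z<s 1<p) a≈0))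

  1≉0 : 1ℤ ≉ 0ℤ
  1≉0 = +≉0 z<s 1<p

  x*y≈0⇒x≈0∨y≈0 : ∀ x y → x * y ≈ 0ℤ → x ≈ 0ℤ ⊎ y ≈ 0ℤ
  x*y≈0⇒x≈0∨y≈0 x y xy≈0 = Sum.map (∣⇒≈0 ∘ ∣ᵤ⇒∣) (∣⇒≈0 ∘ ∣ᵤ⇒∣)
    (euclidsLemma ∣ x ∣ ∣ y ∣ p-prime (subst (p ∣_) (ℤ.abs-* x y) (∣⇒∣ᵤ (≈0⇒∣ xy≈0))))

  *-cancelˡ-≈ : ∀ c {a b} → c ≉ 0ℤ → c * a ≈ c * b → a ≈ b
  *-cancelˡ-≈ c {a} {b} c≉0 ca≈cb =
    [ ⊥-elim ∘ c≉0 , a-b≈0⇒a≈b ]′ (x*y≈0⇒x≈0∨y≈0 c (a - b) c[a-b]≈0)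
    where
      c[a-b]≈0 : c * (a - b) ≈ 0ℤ
      c[a-b]≈0 = subst (_≈ 0ℤ) (*-distribˡ-- c a b) (a≈b⇒a-b≈0 ca≈cb)

  x≉0⇒x^n≉0 : ∀ n {x} → x ≉ 0ℤ → x ^ n ≉ 0ℤ
  x≉0⇒x^n≉0 zero    x≉0 = 1≉0
  x≉0⇒x^n≉0 (suc n) x≉0 = [ x≉0 , x≉0⇒x^n≉0 n x≉0 ]′ ∘ x*y≈0⇒x≈0∨y≈0 _ _

  p∤m! : ∀ {m} → m < p → ¬ p ∣ m !
  p∤m! {zero}  _   p∣1  = ℕ.<⇒≱ 1<p (ℕ.∣⇒≤ p∣1)
  p∤m! {suc m} m<p p∣m! =
    [ (λ p∣1+m → ℕ.<⇒≱ m<p (ℕ.∣⇒≤ p∣1+m)) , p∤m! (ℕ.<-trans (ℕ.n<1+n m) m<p) ]′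
      (euclidsLemma (suc m) (m !) p-prime p∣m!)

  p∣pCk : ∀ {k} → 0 < k → k < p → p ∣ p C k
  p∣pCk {k} 0<k k<p with euclidsLemma (p C k) (k ! ℕ.* (p ∸ k) !) p-prime
                           (subst (p ∣_) (sym (nCk*k![n∸k]!≡n! (ℕ.<⇒≤ k<p))) (n∣n! p))
  ... | inj₁ p∣C            = p∣C
  ... | inj₂ p∣k![p∸k]!  = ⊥-elim ([ p∤m! k<p , p∤m! (ℕ.∸-monoʳ-< 0<k (ℕ.<⇒≤ k<p)) ]′
                                     (euclidsLemma (k !) ((p ∸ k) !) p-prime p∣k![p∸k]!))

  [x+y]^p≈x^p+y^p : ∀ x y → (x + y) ^ p ≈ x ^ p + y ^ p
  [x+y]^p≈x^p+y^p x y = freshmans-dream x y (ℕ.<-trans z<s 1<p) p∣pCk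

  x^p≈x : ∀ x → x ^ p ≈ x
  x^p≈x x = begin
    x ^ p                ≈⟨ ^-congˡ p (x≈x%ℕn x) ⟩
    (+ (x ℤ.%ℕ p)) ^ p   ≈⟨ [+a]^p≈+a (x ℤ.%ℕ p) ⟩
    + (x ℤ.%ℕ p)         ≈⟨ x≈x%ℕn x ⟨
    x                    ∎
    where
      open import Relation.Binary.Reasoning.Setoid ≈-setoid
      [+a]^p≈+a : ∀ a → (+ a) ^ p ≈ + a
      [+a]^p≈+a zero    = ≈-reflexive (subst (λ q → 0ℤ ^ q ≡ 0ℤ) 1+[p-1]≡p refl)
      [+a]^p≈+a (suc a) = begin
        (1ℤ + + a) ^ p      ≈⟨ [x+y]^p≈x^p+y^p 1ℤ (+ a) ⟩
        1ℤ ^ p + (+ a) ^ p  ≈⟨ +-cong (≈-reflexive (ℤ.^-zeroˡ p)) ([+a]^p≈+a a) ⟩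
        1ℤ + + a            ∎

  x^[p-1]≈1 : ∀ {x} → x ≉ 0ℤ → x ^ (p ∸ 1) ≈ 1ℤ
  x^[p-1]≈1 {x} x≉0 = *-cancelˡ-≈ x x≉0 (begin
    x * x ^ (p ∸ 1)  ≡⟨ cong (x ^_) 1+[p-1]≡p ⟩
    x ^ p            ≈⟨ x^p≈x x ⟩
    x                ≡⟨ ℤ.*-identityʳ x ⟨
    x * 1ℤ           ∎)
    where open import Relation.Binary.Reasoning.Setoid ≈-setoid

  lagrange : ∀ {l} cs {rs} → l ≉ 0ℤ → AllPairs _≉_ rs → All (λ r → eval l cs r ≈ 0ℤ) rs →
             length rs ≤ length cs
  lagrange     cs       {[]}     _   _                      _                  = z≤n
  lagrange     []       {r ∷ rs} l≉0 _                      (l≈0 ∷ _)          = ⊥-elim (l≉0 l≈0)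
  lagrange {l} (c ∷ cs) {a ∷ rs} l≉0 (a≉rs ∷ rs-distinct) (fa≈0 ∷ rs-roots) =
    s≤s (subst (length rs ≤_) (length-ruffini l a cs)
          (lagrange (ruffini l a cs) l≉0 rs-distinct (All.zipWith quotient-root (a≉rs , rs-roots))))
    where
      quotient-root : ∀ {b} → a ≉ b × eval l (c ∷ cs) b ≈ 0ℤ → eval l (ruffini l a cs) b ≈ 0ℤ
      quotient-root {b} (a≉b , fb≈0) =
        [ ⊥-elim ∘ a≉b ∘ ≈-sym ∘ a-b≈0⇒a≈b , id ]′
          (x*y≈0⇒x≈0∨y≈0 (b - a) _ (subst (_≈ 0ℤ) (eval-ruffini l a c cs b)
            (a≈b⇒a-b≈0 (≈-trans fb≈0 (≈-sym fa≈0)))))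

  module PowerResidue (e k : ℕ) (ek≡p-1 : suc e ℕ.* suc k ≡ p ∸ 1) where

    [yᵉ]ᵏ≈1 : ∀ {y} → y ≉ 0ℤ → (y ^ suc e) ^ suc k ≈ 1ℤ
    [yᵉ]ᵏ≈1 {y} y≉0 =
      subst (_≈ 1ℤ) (trans (cong (y ^_) (sym ek≡p-1)) (sym (ℤ.^-*-assoc y (suc e) (suc k)))) (x^[p-1]≈1 y≉0)

    residue⇒power≈1 : ∀ {h y} → h ≉ 0ℤ → h ≈ y ^ suc e → h ^ suc k ≈ 1ℤ
    residue⇒power≈1 {h} {y} h≉0 h≈yᵉ = ≈-trans (^-congˡ (suc k) h≈yᵉ) ([yᵉ]ᵏ≈1 y≉0)
      where
        y≉0 : y ≉ 0ℤ
        y≉0 y≈0 = h≉0 (≈-trans h≈yᵉ (*-cong y≈0 (≈-refl {y ^ e})))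

    units : List ℤ
    units = applyUpTo (λ i → + suc i) (p ∸ 1)

    units-distinct : AllPairs _≉_ units
    units-distinct = AllPairs.applyUpTo⁺₁ _ (p ∸ 1) λ i<j j<p-1 i≈j →
      ℕ.<⇒≢ i<j (ℕ.suc-injective (+a≈+b⇒a≡b (≤p-1⇒<p (ℕ.<-trans i<j j<p-1)) (≤p-1⇒<p j<p-1) i≈j))

    stretched-geometric-root : ∀ {h y} → h ^ suc k ≈ 1ℤ → y ≉ 0ℤ → h ≉ y ^ suc e →
                               eval 1ℤ (stretch e (geometric h k)) y ≈ 0ℤ
    stretched-geometric-root {h} {y} hᵏ≈1 y≉0 h≉yᵉ =
      [ ⊥-elim ∘ h≉yᵉ ∘ ≈-sym ∘ a-b≈0⇒a≈b
      , subst (_≈ 0ℤ) (sym (eval-stretch 1ℤ e (geometric h k) y)) ]′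
        (x*y≈0⇒x≈0∨y≈0 (yᵉ - h) _ (subst (_≈ 0ℤ) (sym (eval-geometric h k yᵉ))
          (a≈b⇒a-b≈0 (≈-trans ([yᵉ]ᵏ≈1 y≉0) (≈-sym hᵏ≈1)))))
      where yᵉ = y ^ suc e

    degree<p-1 : k ℕ.* suc e < p ∸ 1
    degree<p-1 = subst (k ℕ.* suc e <_) (trans (ℕ.*-comm (suc k) (suc e)) ek≡p-1)
                   (ℕ.m<n+m (k ℕ.* suc e) z<s)

    -- Otherwise every unit y would be a root of ((y^(e+1))^(k+1) - h^(k+1))/(y^(e+1) - h),
    -- a polynomial of degree k (e + 1) < p - 1.
    power≈1⇒residue : ∀ {h} → h ^ suc k ≈ 1ℤ → ∃[ y ] h ≈ y ^ suc e
    power≈1⇒residue {h} hᵏ≈1 with ℕ.anyUpTo? (λ i → h ≈? (+ suc i) ^ suc e) (p ∸ 1)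
    ... | yes (i , _ , h≈yᵉ) = + suc i , h≈yᵉ
    ... | no ∄i = ⊥-elim (ℕ.<⇒≱ degree<p-1 p-1≤degree)
      where
        G = stretch e (geometric h k)
        units-roots : All (λ y → eval 1ℤ G y ≈ 0ℤ) units
        units-roots = All.applyUpTo⁺₁ _ (p ∸ 1) λ i<p-1 →
          stretched-geometric-root hᵏ≈1 (+≉0 z<s (≤p-1⇒<p i<p-1)) (λ h≈yᵉ → ∄i (_ , i<p-1 , h≈yᵉ))
        p-1≤degree : p ∸ 1 ≤ k ℕ.* suc e
        p-1≤degree = subst₂ _≤_ (List.length-applyUpTo _ (p ∸ 1))
                       (trans (length-stretch e (geometric h k)) (cong (ℕ._* suc e) (length-geometric h k)))
                       (lagrange G 1≉0 units-distinct units-roots)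

    euler-criterion : ∀ {h} → h ≉ 0ℤ → (∃[ y ] h ≈ y ^ suc e) ⇔ h ^ suc k ≈ 1ℤ
    euler-criterion h≉0 =
      mk⇔ (λ (y , h≈yᵉ) → residue⇒power≈1 {y = y} h≉0 h≈yᵉ) power≈1⇒residue

module Correspondence {p : ℕ} (p-prime : Prime p) (e′ k′ : ℕ)
                      (ek≡p-1 : suc e′ ℕ.* suc k′ ≡ p ∸ 1) where

  open Congruence p
  open PrimeModulus p-prime
  open PowerResidue e′ k′ ek≡p-1

  e k : ℕ
  e = suc e′
  k = suc k′

  kᵏ≉0 : (+ k) ^ k ≉ 0ℤ
  kᵏ≉0 = x≉0⇒x^n≉0 k (+≉0 z<s (≤p-1⇒<p (subst (k ≤_) ek≡p-1 (ℕ.m≤n*m k e))))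

  k*e≈-1 : + k * + e ≈ -1ℤ
  k*e≈-1 = subst (_≈ -1ℤ) (cong +_ (trans (sym ek≡p-1) (ℕ.*-comm e k))) ([n-1]≈-1 (ℕ.<-trans z<s 1<p))

  [ej]ᵏ≈1⇔-jᵏ≈kᵏ : ∀ j → (+ (e ℕ.* j)) ^ k ≈ 1ℤ ⇔ (- + j) ^ k ≈ (+ k) ^ k
  [ej]ᵏ≈1⇔-jᵏ≈kᵏ j = mk⇔
    (λ [ej]ᵏ≈1 → begin
      (- + j) ^ k  ≈⟨ scaled ⟨
      K * H        ≈⟨ *-cong (≈-refl {K}) [ej]ᵏ≈1 ⟩
      K * 1ℤ       ≡⟨ ℤ.*-identityʳ K ⟩
      K            ∎)
    (λ -jᵏ≈kᵏ → *-cancelˡ-≈ K kᵏ≉0 (begin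
      K * H        ≈⟨ scaled ⟩
      (- + j) ^ k  ≈⟨ -jᵏ≈kᵏ ⟩
      K            ≡⟨ ℤ.*-identityʳ K ⟨
      K * 1ℤ       ∎))
    where
      K = (+ k) ^ k
      H = (+ (e ℕ.* j)) ^ k
      scaled : K * H ≈ (- + j) ^ k
      scaled = subst (λ ej → K * ej ^ k ≈ (- + j) ^ k) (sym (ℤ.pos-* e j))
                 (power-scaling {+ k} {+ e} k*e≈-1 k (+ j))
      open import Relation.Binary.Reasoning.Setoid ≈-setoid

  residue⇔-jᵏ≈kᵏ : ∀ {j} → 0 < e ℕ.* j → e ℕ.* j ≤ p ∸ 1 →
                   (∃ λ y → (+ (e ℕ.* j)) ≡ (y ^ e) [mod p ]) ⇔ ((- + j) ^ k) ≡ ((+ k) ^ k) [mod p ]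
  residue⇔-jᵏ≈kᵏ {j} 0<ej ej≤p-1 = mk⇔
    (≈⇒≡[mod] ∘ Equivalence.to residue⇔ ∘ map₂ ≡[mod]⇒≈)
    (map₂ ≈⇒≡[mod] ∘ Equivalence.from residue⇔ ∘ ≡[mod]⇒≈)
    where
      residue⇔ = ⇔.trans (euler-criterion (+≉0 0<ej (≤p-1⇒<p ej≤p-1))) ([ej]ᵏ≈1⇔-jᵏ≈kᵏ j)

  gcd[ej,p-1]≡e*gcd[j,k] : ∀ j → gcd (e ℕ.* j) (p ∸ 1) ≡ e ℕ.* gcd j k
  gcd[ej,p-1]≡e*gcd[j,k] j = trans (cong (gcd (e ℕ.* j)) (sym ek≡p-1)) (sym (c*gcd[m,n]≡gcd[cm,cn] e j k))

  JSet⇒TSet : ∀ {j} → JSet k p j → TSet e p (e ℕ.* j)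
  JSet⇒TSet {j} (1≤j , j≤k , gcd[j,k]≡1 , -jᵏ≡kᵏ) =
    0<ej , ej≤p-1 , Equivalence.from (residue⇔-jᵏ≈kᵏ 0<ej ej≤p-1) -jᵏ≡kᵏ ,
    trans (gcd[ej,p-1]≡e*gcd[j,k] j) (trans (cong (e ℕ.*_) gcd[j,k]≡1) (ℕ.*-identityʳ e))
    where
      0<ej = ℕ.≤-trans 1≤j (ℕ.m≤n*m j e)
      ej≤p-1 = subst (e ℕ.* j ≤_) ek≡p-1 (ℕ.*-monoʳ-≤ e j≤k)

  TSet⇒JSet : ∀ {j} → TSet e p (e ℕ.* j) → JSet k p j
  TSet⇒JSet {j} (0<ej , ej≤p-1 , residue , gcd[ej,p-1]≡e) =
    ℕ.>-nonZero⁻¹ j {{ℕ.m*n≢0⇒n≢0 e {{ℕ.>-nonZero 0<ej}}}} ,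
    ℕ.*-cancelˡ-≤ e (subst (e ℕ.* j ≤_) (sym ek≡p-1) ej≤p-1) ,
    ℕ.*-cancelˡ-≡ (gcd j k) 1 e
      (trans (sym (gcd[ej,p-1]≡e*gcd[j,k] j)) (trans gcd[ej,p-1]≡e (sym (ℕ.*-identityʳ e)))) ,
    Equivalence.to (residue⇔-jᵏ≈kᵏ 0<ej ej≤p-1) residue

  TSet⇒multiple : ∀ {h} → TSet e p h → ∃[ j ] h ≡ e ℕ.* j
  TSet⇒multiple {h} (_ , _ , _ , gcd[h,p-1]≡e) =
    _ , ℕ.m∣n⇒n≡m*quotient (subst (ℕ._∣ h) gcd[h,p-1]≡e (gcd[m,n]∣m h (p ∸ 1)))

  JSet? : Decidable (JSet k p)
  JSet? j = (1 ℕ.≤? j) ×-dec (j ℕ.≤? k) ×-dec (gcd j k ℕ.≟ 1)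
            ×-dec map′ ≈⇒≡[mod] ≡[mod]⇒≈ ((- + j) ^ k ≈? (+ k) ^ k)

  equinumerous : ∃ λ n → HasSize (TSet e p) n × HasSize (JSet k p) n
  equinumerous =
    _ , HasSize-map (e ℕ.*_) (ℕ.*-cancelˡ-≡ _ _ e) TSet⇒multiple (λ _ → mk⇔ JSet⇒TSet TSet⇒JSet) JSet-size
      , JSet-size
    where
      JSet-size = HasSize-filter JSet? (suc k) (λ (_ , j≤k , _) → s≤s j≤k)

lemma7 : (p k : ℕ) → Prime p → .{{_ : NonZero k}} → k ∣ p ∸ 1
       → ∃ λ (n : ℕ) → HasSize (TSet ((p ∸ 1) / k) p) n × HasSize (JSet k p) n
lemma7 p zero     p-prime {{k≢0}} _ = ⊥-elim (ℕ.≢-nonZero⁻¹ 0 {{k≢0}} refl)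
lemma7 p (suc k′) p-prime k∣p-1 with (p ∸ 1) / suc k′ | ℕ.m/n*n≡m k∣p-1
... | zero    | 0≡p-1  = ⊥-elim (ℕ.<⇒≢ (ℕ.m<n⇒0<n∸m (PrimeModulus.1<p p-prime)) 0≡p-1)
... | suc e′  | ek≡p-1 = Correspondence.equinumerous p-prime e′ k′ ek≡p-1
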